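{- Let $T$ be a 2-3 red-black tree and let $k$ be a key stored in $T$. Apply the parity-seeking deletion algorithm for 2-3 red-black trees (described in the context) to delete $k$ from $T$. Then the algorithm terminates after finitely many fix-up steps, and the tree it produces is a legitimate 2-3 red-black tree.
   Context: A red-black (RB) tree is a binary search tree in which each node is colored red or black, such that: (1) the root is black; (2) the parent of every red node is black; (3) every path from the root to an external node contains the same number of black nodes. Here null child pointers are regarded as pointers to imaginary black external nodes ("nil"). A 2-3 red-black tree is an RB tree in which no node has two red children. A subtree rooted at a node $x$ is called deficient if (i) ignoring the color of $x$, it satisfies the 2-3 RB tree conditions, and (ii) the number of black nodes on a path from $x$ to an external node is one less than the corresponding number for the sibling of $x$. The parity-seeking deletion algorithm. First, if the node holding $k$ has two children, its key is replaced by the largest key of its left subtree (or the smallest key of its right subtree) and the deletion is transferred to the node that held that key; hence the node $z$ to be removed has at most one child. If $z$ has exactly one child, that child is a red leaf; its key is copied into $z$ and the child is removed; stop. If $z$ is a red leaf, it is removed; stop. If $z$ is a black leaf, it is removed and replaced by an external node $x$ (black), whose subtree is now deficient. Then repeat the following, where $p$ is the parent of $x$ and $y$ is the sibling of $x$; the rules are stated for $x$ a left child, and the mirror-image rules (left and right exchanged) apply when $x$ is a right child: (Root) If $x$ is the root of the whole tree, color $x$ black and stop. (Case I) If $x$ is red, color $x$ black and stop. (Case II) If $x$ and $y$ are both black: (a) if both children of $y$ are black, color $y$ red and set $x := p$, then continue; (b) if the right child of $y$ is red, left-rotate at $p$, give $y$ the original color of $p$, color $p$ and the right child of $y$ black,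 and stop; (c) if the right child of $y$ is black and its left child $w$ is red, right-rotate at $y$ and then left-rotate at $p$, give $w$ the original color of $p$, color $p$ and $y$ black, and stop. (Case III) If $x$ is black and $y$ is red, left-rotate at $p$, color $y$ black and $p$ red, and continue with the same $x$, whose new sibling is the former left child of $y$. -}

module Defs where

open import Level using (_⊔_)
open import Data.Nat using (ℕ; zero; suc)
open import Data.List using (List; []; _∷_; _++_)
open import Data.Maybe using (Maybe; just; nothing)
open import Data.Product using (Σ; _×_; _,_)
open import Relation.Binary.PropositionalEquality using (_≡_)
open import Relation.Nullary using (¬_)
open import Relation.Binary.Bundles using (StrictTotalOrder)
open import Relation.Binary.Definitions using (tri<; tri≈; tri>)

data Color : Set where
  red black : Color

-- Which key replaces a deleted key held in a node with two children:
-- the largest key of the left subtree, or the smallest key of the right subtree.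
data Side : Set where
  predecessor successor : Side

module RB {a ℓ₁ ℓ₂} (O : StrictTotalOrder a ℓ₁ ℓ₂) where
  open StrictTotalOrder O public using (_≈_; _<_; compare)

  Key : Set a
  Key = StrictTotalOrder.Carrier O

  -- nil = external (imaginary black) node
  data Tree : Set a where
    nil  : Tree
    node : Color → Tree → Key → Tree → Tree

  colorOf : Tree → Color
  colorOf nil            = black
  colorOf (node c _ _ _) = c

  blacken : Tree → Tree
  blacken nil            = nil
  blacken (node _ l k r) = node black l k r

  data AllT (P : Key → Set ℓ₂) : Tree → Set (a ⊔ ℓ₂) where
    nil  : AllT P nil
    node : ∀ {c l k r} → P k → AllT P l → AllT P r → AllT P (node c l k r)

  data Ordered : Tree → Set (a ⊔ ℓ₂) where
    nil  : Ordered nil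
    node : ∀ {c l k r} → AllT (_< k) l → AllT (k <_) r →
           Ordered l → Ordered r → Ordered (node c l k r)

  data RedParentBlack : Tree → Set a where
    nil  : RedParentBlack nil
    node : ∀ {c l k r} →
           (c ≡ red → colorOf l ≡ black × colorOf r ≡ black) →
           RedParentBlack l → RedParentBlack r → RedParentBlack (node c l k r)

  data NoTwoRedChildren : Tree → Set a where
    nil  : NoTwoRedChildren nil
    node : ∀ {c l k r} → ¬ (colorOf l ≡ red × colorOf r ≡ red) →
           NoTwoRedChildren l → NoTwoRedChildren r → NoTwoRedChildren (node c l k r)

  data BlackHeight : Tree → ℕ → Set a where
    nil   : BlackHeight nil zero
    black : ∀ {l k r n} → BlackHeight l n → BlackHeight r n →
            BlackHeight (node black l k r) (suc n)
    red   : ∀ {l k r n} → BlackHeight l n → BlackHeight r n →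
            BlackHeight (node red l k r) n

  Is23RB : Tree → Set (a ⊔ ℓ₂)
  Is23RB T = Ordered T × colorOf T ≡ black × RedParentBlack T ×
             Σ ℕ (BlackHeight T) × NoTwoRedChildren T

  data _∈T_ (k : Key) : Tree → Set (a ⊔ ℓ₁) where
    here  : ∀ {c l k′ r} → k ≈ k′ → k ∈T node c l k′ r
    left  : ∀ {c l k′ r} → k ∈T l → k ∈T node c l k′ r
    right : ∀ {c l k′ r} → k ∈T r → k ∈T node c l k′ r

  -- Zippers: a focused subtree together with the path to the root
  -- (the head frame describes the parent).

  data Frame : Set a where
    inL : Color → Key → Tree → Frame   -- focus is the left child of  node c _ k r
    inR : Color → Tree → Key → Frame   -- focus is the right child of node c l k _

  Path : Set a
  Path = List Frame

  plug : Tree → Path → Tree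
  plug t []                = t
  plug t (inL c k r ∷ ps) = plug (node c t k r) ps
  plug t (inR c l k ∷ ps) = plug (node c l k t) ps

  -- State of the algorithm: finished with a tree, or in the fix-up loop
  -- with the deficient subtree x and its path to the root.
  data Result : Set a where
    done  : Tree → Result
    fixup : Tree → Path → Result

  find : Key → Tree → Path → Maybe (Tree × Path)
  find k nil ps = nothing
  find k (node c l k′ r) ps with compare k k′
  ... | tri< _ _ _ = find k l (inL c k′ r ∷ ps)
  ... | tri≈ _ _ _ = just (node c l k′ r , ps)
  ... | tri> _ _ _ = find k r (inR c l k′ ∷ ps)

  goMax : Tree → Path → Tree × Path
  goMax nil ps = nil , ps
  goMax (node c l k nil) ps = node c l k nil , ps
  goMax (node c l k (node c′ l′ k′ r′)) ps = goMax (node c′ l′ k′ r′) (inR c l k ∷ ps)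

  goMin : Tree → Path → Tree × Path
  goMin nil ps = nil , ps
  goMin (node c nil k r) ps = node c nil k r , ps
  goMin (node c (node c′ l′ k′ r′) k r) ps = goMin (node c′ l′ k′ r′) (inL c k r ∷ ps)

  removeAt : Tree → Path → Result
  removeAt nil ps = done (plug nil ps)                            -- (unreachable)
  removeAt (node red   nil k nil) ps = done (plug nil ps)
  removeAt (node black nil k nil) ps = fixup nil ps
  removeAt (node c (node _ _ k′ _) k nil) ps = done (plug (node c nil k′ nil) ps)
  removeAt (node c nil k (node _ _ k′ _)) ps = done (plug (node c nil k′ nil) ps)
  removeAt (node c (node c₁ l₁ k₁ r₁) k (node c₂ l₂ k₂ r₂)) ps =   -- (unreachable)
    done (plug (node c (node c₁ l₁ k₁ r₁) k (node c₂ l₂ k₂ r₂)) ps)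

  replaceMax : Color → Tree × Path → Tree → Path → Result
  replaceMax c (node cm lm km rm , ps′) r ps =
    removeAt (node cm lm km rm) (ps′ ++ inL c km r ∷ ps)
  replaceMax c (nil , ps′) r ps = done (plug nil ps)               -- (unreachable)

  replaceMin : Color → Tree → Tree × Path → Path → Result
  replaceMin c l (node cm lm km rm , ps′) ps =
    removeAt (node cm lm km rm) (ps′ ++ inR c l km ∷ ps)
  replaceMin c l (nil , ps′) ps = done (plug nil ps)               -- (unreachable)

  transfer : Side → Tree → Path → Result
  transfer predecessor (node c (node c₁ l₁ k₁ r₁) k (node c₂ l₂ k₂ r₂)) ps =
    replaceMax c (goMax (node c₁ l₁ k₁ r₁) []) (node c₂ l₂ k₂ r₂) ps
  transfer successor (node c (node c₁ l₁ k₁ r₁) k (node c₂ l₂ k₂ r₂)) ps =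
    replaceMin c (node c₁ l₁ k₁ r₁) (goMin (node c₂ l₂ k₂ r₂) []) ps
  transfer _ nil ps = removeAt nil ps
  transfer _ (node c nil k r) ps = removeAt (node c nil k r) ps
  transfer _ (node c (node c₁ l₁ k₁ r₁) k nil) ps = removeAt (node c (node c₁ l₁ k₁ r₁) k nil) ps

  startDelete : Side → Key → Tree → Result
  startDelete s k T with find k T []
  ... | nothing       = done T
  ... | just (z , ps) = transfer s z ps

  -- x is a left child: Case II with black sibling  node black a ky b
  caseIIcL : Tree → Color → Key → Tree → Key → Tree → Path → Result
  caseIIcL x cp kp (node red a₁ kw a₂) ky b ps =
    done (plug (node cp (node black x kp a₁) kw (node black a₂ ky b)) ps)
  caseIIcL x cp kp a ky b ps =
    fixup (node cp x kp (node red a ky b)) ps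

  caseIIL : Tree → Color → Key → Tree → Key → Tree → Path → Result
  caseIIL x cp kp a ky b ps with colorOf b
  ... | red   = done (plug (node cp (node black x kp a) ky (blacken b)) ps)
  ... | black = caseIIcL x cp kp a ky b ps

  stepL : Tree → Color → Key → Tree → Path → Result
  stepL x cp kp (node black a ky b) ps = caseIIL x cp kp a ky b ps
  stepL x cp kp (node red a ky b) ps =
    fixup x (inL red kp a ∷ inL black ky b ∷ ps)
  stepL x cp kp nil ps = done (plug (node cp x kp nil) ps)         -- (unreachable)

  -- mirror images: x is a right child, sibling y = node _ a ky b on the left
  caseIIcR : Tree → Color → Tree → Key → Tree → Key → Path → Result
  caseIIcR x cp a ky (node red b₁ kw b₂) kp ps =
    done (plug (node cp (node black a ky b₁) kw (node black b₂ kp x)) ps)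
  caseIIcR x cp a ky b kp ps =
    fixup (node cp (node red a ky b) kp x) ps

  caseIIR : Tree → Color → Tree → Key → Tree → Key → Path → Result
  caseIIR x cp a ky b kp ps with colorOf a
  ... | red   = done (plug (node cp (blacken a) ky (node black b kp x)) ps)
  ... | black = caseIIcR x cp a ky b kp ps

  stepR : Tree → Color → Tree → Key → Path → Result
  stepR x cp (node black a ky b) kp ps = caseIIR x cp a ky b kp ps
  stepR x cp (node red a ky b) kp ps =
    fixup x (inR red b kp ∷ inR black a ky ∷ ps)
  stepR x cp nil kp ps = done (plug (node cp nil kp x) ps)         -- (unreachable)

  stepBlack : Tree → Path → Result
  stepBlack x [] = done (blacken x)
  stepBlack x (inL cp kp y ∷ ps) = stepL x cp kp y ps
  stepBlack x (inR cp y kp ∷ ps) = stepR x cp y kp ps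

  step : Tree → Path → Result
  step x [] = done (blacken x)
  step x (f ∷ ps) with colorOf x
  ... | red   = done (plug (blacken x) (f ∷ ps))
  ... | black = stepBlack x (f ∷ ps)

  run : ℕ → Result → Maybe Tree
  run _       (done t)     = just t
  run zero    (fixup _ _)  = nothing
  run (suc n) (fixup x ps) = run n (step x ps)

-- Two invariants are maintained separately.  Every rotation and recolouring of the
-- fix-up loop leaves the in-order key sequence unchanged, and the initial removal only
-- drops keys from it, so the result's sequence is a sublist of the original sorted one.
-- During the loop the deficient subtree x sits at a position demanding black height one
-- more than x has, with the rest of the tree legitimate.  Case II(a) moves x one level
-- up; Case III makes the parent of x red, after which Case II either stops or moves x
-- onto that red parent, where Case I stops.  So the loop terminates by recursion on the
-- path from x to the root.

module Submission where

open import Defs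
open import Level using (_⊔_)
open import Data.Nat using (ℕ; zero; suc)
open import Data.List using (List; []; _∷_; _++_)
open import Data.List.Properties using (++-assoc; ++-identityʳ)
open import Data.List.Relation.Unary.All as All using (All; []; _∷_)
open import Data.List.Relation.Unary.All.Properties
  using () renaming (++⁺ to All-++⁺; ++⁻ to All-++⁻)
open import Data.List.Relation.Unary.AllPairs using (AllPairs; []; _∷_)
open import Data.List.Relation.Unary.AllPairs.Properties
  using () renaming (++⁺ to AllPairs-++⁺)
open import Data.List.Relation.Binary.Sublist.Propositional
  using (_⊆_; []; _∷_; _∷ʳ_; ⊆-refl; ⊆-trans; ⊆-reflexive; ⊆-preorder)
open import Data.List.Relation.Binary.Sublist.Propositional.Properties
  using (All-resp-⊆; ++⁺; ++⁺ˡ; ++⁺ʳ; []⊆-universal)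
import Relation.Binary.Reasoning.Preorder as PreorderReasoning
open import Data.Maybe using (just; nothing)
open import Data.Product using (Σ; ∃; ∃₂; _×_; _,_)
open import Relation.Binary.Core using (Rel)
open import Relation.Binary.PropositionalEquality
  using (_≡_; refl; sym; trans; cong; subst; module ≡-Reasoning)
open import Relation.Nullary using (¬_)
open import Relation.Binary.Bundles using (StrictTotalOrder)
open import Relation.Binary.Definitions using (tri<; tri≈; tri>)

module _ {a r} {A : Set a} {R : Rel A r} where

  AllPairs-resp-⊆ : ∀ {xs ys} → xs ⊆ ys → AllPairs R ys → AllPairs R xs
  AllPairs-resp-⊆ []         []       = []
  AllPairs-resp-⊆ (_ ∷ʳ τ)   (_ ∷ ps) = AllPairs-resp-⊆ τ ps
  AllPairs-resp-⊆ (refl ∷ τ) (p ∷ ps) = All-resp-⊆ τ p ∷ AllPairs-resp-⊆ τ ps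

  AllPairs-++⁻ : ∀ xs {ys} → AllPairs R (xs ++ ys) →
                 AllPairs R xs × AllPairs R ys × All (λ x → All (R x) ys) xs
  AllPairs-++⁻ []       ps       = [] , ps , []
  AllPairs-++⁻ (x ∷ xs) (p ∷ ps) =
    let pxs , pys , cross = AllPairs-++⁻ xs ps
        px , pcross       = All-++⁻ xs p
    in px ∷ pxs , pys , pcross ∷ cross

module Deletion {a ℓ₁ ℓ₂} (O : StrictTotalOrder a ℓ₁ ℓ₂) where
  open RB O
  open StrictTotalOrder O using () renaming (trans to <-trans)

  module ⊆-Reasoning = PreorderReasoning (⊆-preorder {A = Key})

  plug-++ : ∀ t ps qs → plug t (ps ++ qs) ≡ plug (plug t ps) qs
  plug-++ t []               qs = refl
  plug-++ t (inL c k r ∷ ps) qs = plug-++ (node c t k r) ps qs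
  plug-++ t (inR c l k ∷ ps) qs = plug-++ (node c l k t) ps qs

  find-plug : ∀ k T acc {z qs} → find k T acc ≡ just (z , qs) → plug z qs ≡ plug T acc
  find-plug k (node c l k′ r) acc e with compare k k′
  ... | tri< _ _ _ = find-plug k l (inL c k′ r ∷ acc) e
  ... | tri≈ _ _ _ with refl ← e = refl
  ... | tri> _ _ _ = find-plug k r (inR c l k′ ∷ acc) e

  data RightSpine : Path → Set a where
    []    : RightSpine []
    right : ∀ {c l k ps} → RightSpine ps → RightSpine (inR c l k ∷ ps)

  data LeftSpine : Path → Set a where
    []   : LeftSpine []
    left : ∀ {c k r ps} → LeftSpine ps → LeftSpine (inL c k r ∷ ps)

  goMax-spec : ∀ c l k r {acc} → RightSpine acc →
    ∃₂ λ cm lm → ∃₂ λ km qs →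
      goMax (node c l k r) acc ≡ (node cm lm km nil , qs) ×
      plug (node cm lm km nil) qs ≡ plug (node c l k r) acc × RightSpine qs
  goMax-spec c l k nil                spine = c , l , k , _ , refl , refl , spine
  goMax-spec c l k (node c′ l′ k′ r′) spine = goMax-spec c′ l′ k′ r′ (right spine)

  goMin-spec : ∀ c l k r {acc} → LeftSpine acc →
    ∃₂ λ cm km → ∃₂ λ rm qs →
      goMin (node c l k r) acc ≡ (node cm nil km rm , qs) ×
      plug (node cm nil km rm) qs ≡ plug (node c l k r) acc × LeftSpine qs
  goMin-spec c nil                k r spine = c , k , r , _ , refl , refl , spine
  goMin-spec c (node c′ l′ k′ r′) k r spine = goMin-spec c′ l′ k′ r′ (left spine)

  inorder : Tree → List Key
  inorder nil            = []
  inorder (node _ l k r) = inorder l ++ k ∷ inorder r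

  Sorted : List Key → Set (a ⊔ ℓ₂)
  Sorted = AllPairs _<_

  AllT⇒All : ∀ {P t} → AllT P t → All P (inorder t)
  AllT⇒All nil            = []
  AllT⇒All (node p pl pr) = All-++⁺ (AllT⇒All pl) (p ∷ AllT⇒All pr)

  All⇒AllT : ∀ {P} t → All P (inorder t) → AllT P t
  All⇒AllT nil            _ = nil
  All⇒AllT (node _ l _ r) ps with All-++⁻ (inorder l) ps
  ... | pl , p ∷ pr = node p (All⇒AllT l pl) (All⇒AllT r pr)

  Ordered⇒Sorted : ∀ {t} → Ordered t → Sorted (inorder t)
  Ordered⇒Sorted nil = []
  Ordered⇒Sorted (node l<k k<r ol or) =
    AllPairs-++⁺ (Ordered⇒Sorted ol) (AllT⇒All k<r ∷ Ordered⇒Sorted or)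
      (All.map (λ x<k → x<k ∷ All.map (<-trans x<k) (AllT⇒All k<r)) (AllT⇒All l<k))

  Sorted⇒Ordered : ∀ t → Sorted (inorder t) → Ordered t
  Sorted⇒Ordered nil            _ = nil
  Sorted⇒Ordered (node _ l _ r) s with AllPairs-++⁻ (inorder l) s
  ... | sl , k<r ∷ sr , l<kr =
    node (All⇒AllT l (All.map All.head l<kr)) (All⇒AllT r k<r)
         (Sorted⇒Ordered l sl) (Sorted⇒Ordered r sr)

  inorder-blacken : ∀ t → inorder (blacken t) ≡ inorder t
  inorder-blacken nil            = refl
  inorder-blacken (node _ _ _ _) = refl

  plug-⊆ : ∀ t u ps → inorder t ⊆ inorder u → inorder (plug t ps) ⊆ inorder (plug u ps)
  plug-⊆ t u []               τ = τ
  plug-⊆ t u (inL c k r ∷ ps) τ =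
    plug-⊆ (node c t k r) (node c u k r) ps (++⁺ τ ⊆-refl)
  plug-⊆ t u (inR c l k ∷ ps) τ =
    plug-⊆ (node c l k t) (node c l k u) ps (++⁺ ⊆-refl (refl ∷ τ))

  reshape-⊆ : ∀ t u ps → inorder t ≡ inorder u → inorder (plug t ps) ⊆ inorder (plug u ps)
  reshape-⊆ t u ps e = plug-⊆ t u ps (⊆-reflexive e)

  contents : Result → List Key
  contents (done t)     = inorder t
  contents (fixup x ps) = inorder (plug x ps)

  caseIIcL-⊆ : ∀ x cp kp a ky b ps →
    contents (caseIIcL x cp kp a ky b ps) ⊆ inorder (plug (node cp x kp (node black a ky b)) ps)
  caseIIcL-⊆ x cp kp (node red a₁ kw a₂) ky b ps = reshape-⊆ _ _ ps (begin
      (X ++ kp ∷ A₁) ++ kw ∷ (A₂ ++ ky ∷ B)  ≡⟨ ++-assoc X (kp ∷ A₁) _ ⟩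
      X ++ kp ∷ (A₁ ++ kw ∷ (A₂ ++ ky ∷ B))  ≡⟨ cong (λ zs → X ++ kp ∷ zs) (++-assoc A₁ _ _) ⟨
      X ++ kp ∷ ((A₁ ++ kw ∷ A₂) ++ ky ∷ B)  ∎)
    where
    open ≡-Reasoning
    X = inorder x; A₁ = inorder a₁; A₂ = inorder a₂; B = inorder b
  caseIIcL-⊆ x cp kp nil                 ky b ps = reshape-⊆ _ _ ps refl
  caseIIcL-⊆ x cp kp (node black _ _ _) ky b ps = reshape-⊆ _ _ ps refl

  caseIIL-⊆ : ∀ x cp kp a ky b ps →
    contents (caseIIL x cp kp a ky b ps) ⊆ inorder (plug (node cp x kp (node black a ky b)) ps)
  caseIIL-⊆ x cp kp a ky b ps with colorOf b
  ... | black = caseIIcL-⊆ x cp kp a ky b ps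
  ... | red   = reshape-⊆ _ _ ps (begin
      XA ++ ky ∷ inorder (blacken b)   ≡⟨ cong (λ zs → XA ++ ky ∷ zs) (inorder-blacken b) ⟩
      XA ++ ky ∷ inorder b             ≡⟨ ++-assoc X (kp ∷ A) _ ⟩
      X ++ kp ∷ (A ++ ky ∷ inorder b)  ∎)
    where
    open ≡-Reasoning
    X = inorder x; A = inorder a; XA = X ++ kp ∷ A

  stepL-⊆ : ∀ x cp kp y ps →
    contents (stepL x cp kp y ps) ⊆ inorder (plug (node cp x kp y) ps)
  stepL-⊆ x cp kp nil                ps = ⊆-refl
  stepL-⊆ x cp kp (node black a ky b) ps = caseIIL-⊆ x cp kp a ky b ps
  stepL-⊆ x cp kp (node red   a ky b) ps =
    reshape-⊆ _ _ ps (++-assoc (inorder x) (kp ∷ inorder a) (ky ∷ inorder b))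

  caseIIcR-⊆ : ∀ x cp a ky b kp ps →
    contents (caseIIcR x cp a ky b kp ps) ⊆ inorder (plug (node cp (node black a ky b) kp x) ps)
  caseIIcR-⊆ x cp a ky (node red b₁ kw b₂) kp ps = reshape-⊆ _ _ ps (begin
      (A ++ ky ∷ B₁) ++ kw ∷ (B₂ ++ kp ∷ X)  ≡⟨ ++-assoc A (ky ∷ B₁) _ ⟩
      A ++ ky ∷ (B₁ ++ kw ∷ (B₂ ++ kp ∷ X))  ≡⟨ cong (λ zs → A ++ ky ∷ zs) (++-assoc B₁ _ _) ⟨
      A ++ ky ∷ ((B₁ ++ kw ∷ B₂) ++ kp ∷ X)  ≡⟨ ++-assoc A _ _ ⟨
      (A ++ ky ∷ (B₁ ++ kw ∷ B₂)) ++ kp ∷ X  ∎)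
    where
    open ≡-Reasoning
    X = inorder x; A = inorder a; B₁ = inorder b₁; B₂ = inorder b₂
  caseIIcR-⊆ x cp a ky nil                 kp ps = reshape-⊆ _ _ ps refl
  caseIIcR-⊆ x cp a ky (node black _ _ _) kp ps = reshape-⊆ _ _ ps refl

  caseIIR-⊆ : ∀ x cp a ky b kp ps →
    contents (caseIIR x cp a ky b kp ps) ⊆ inorder (plug (node cp (node black a ky b) kp x) ps)
  caseIIR-⊆ x cp a ky b kp ps with colorOf a
  ... | black = caseIIcR-⊆ x cp a ky b kp ps
  ... | red   = reshape-⊆ _ _ ps (begin
      inorder (blacken a) ++ ky ∷ (B ++ kp ∷ X)  ≡⟨ cong (_++ ky ∷ (B ++ kp ∷ X)) (inorder-blacken a) ⟩
      inorder a ++ ky ∷ (B ++ kp ∷ X)            ≡⟨ ++-assoc (inorder a) (ky ∷ B) _ ⟨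
      (inorder a ++ ky ∷ B) ++ kp ∷ X            ∎)
    where
    open ≡-Reasoning
    X = inorder x; B = inorder b

  stepR-⊆ : ∀ x cp y kp ps →
    contents (stepR x cp y kp ps) ⊆ inorder (plug (node cp y kp x) ps)
  stepR-⊆ x cp nil                kp ps = ⊆-refl
  stepR-⊆ x cp (node black a ky b) kp ps = caseIIR-⊆ x cp a ky b kp ps
  stepR-⊆ x cp (node red   a ky b) kp ps =
    reshape-⊆ _ _ ps (sym (++-assoc (inorder a) (ky ∷ inorder b) (kp ∷ inorder x)))

  step-⊆ : ∀ x ps → contents (step x ps) ⊆ inorder (plug x ps)
  step-⊆ x [] = ⊆-reflexive (inorder-blacken x)
  step-⊆ x (f ∷ ps) with colorOf x
  step-⊆ x (f ∷ ps)           | red   = reshape-⊆ (blacken x) x (f ∷ ps) (inorder-blacken x)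
  step-⊆ x (inL cp kp y ∷ ps) | black = stepL-⊆ x cp kp y ps
  step-⊆ x (inR cp y kp ∷ ps) | black = stepR-⊆ x cp y kp ps

  run-⊆ : ∀ n R {T} → run n R ≡ just T → inorder T ⊆ contents R
  run-⊆ n       (done t)     refl = ⊆-refl
  run-⊆ (suc n) (fixup x ps) e    = ⊆-trans (run-⊆ n (step x ps) e) (step-⊆ x ps)

  inorder-plug-rightSpine : ∀ {qs} → RightSpine qs → ∀ t u xs →
    inorder t ≡ inorder u ++ xs → inorder (plug t qs) ≡ inorder (plug u qs) ++ xs
  inorder-plug-rightSpine []                        t u xs e = e
  inorder-plug-rightSpine (right {c} {l} {k} spine) t u xs e =
    inorder-plug-rightSpine spine (node c l k t) (node c l k u) xs
      (trans (cong (λ zs → inorder l ++ k ∷ zs) e) (sym (++-assoc (inorder l) _ xs)))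

  inorder-plug-leftSpine : ∀ {qs} → LeftSpine qs → ∀ t u xs →
    inorder t ≡ xs ++ inorder u → inorder (plug t qs) ≡ xs ++ inorder (plug u qs)
  inorder-plug-leftSpine []                       t u xs e = e
  inorder-plug-leftSpine (left {c} {k} {r} spine) t u xs e =
    inorder-plug-leftSpine spine (node c t k r) (node c u k r) xs
      (trans (cong (_++ k ∷ inorder r) e) (++-assoc xs (inorder u) (k ∷ inorder r)))

  replace-by-max-⊆ : ∀ {qs} → RightSpine qs → ∀ c cm lm km k r →
    inorder (node c (plug lm qs) km r) ⊆ inorder (node c (plug (node cm lm km nil) qs) k r)
  replace-by-max-⊆ {qs} spine c cm lm km k r = begin
    P ++ km ∷ R                                     ∼⟨ ++⁺ ⊆-refl (refl ∷ k ∷ʳ ⊆-refl) ⟩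
    P ++ km ∷ k ∷ R                                 ≡⟨ ++-assoc P (km ∷ []) (k ∷ R) ⟨
    (P ++ km ∷ []) ++ k ∷ R                         ≡⟨ cong (_++ k ∷ R) max-last ⟨
    inorder (plug (node cm lm km nil) qs) ++ k ∷ R  ∎
    where
    open ⊆-Reasoning
    P = inorder (plug lm qs); R = inorder r
    max-last : inorder (plug (node cm lm km nil) qs) ≡ P ++ km ∷ []
    max-last = inorder-plug-rightSpine spine (node cm lm km nil) lm (km ∷ []) refl

  replace-by-min-⊆ : ∀ {qs} → LeftSpine qs → ∀ c l k cm km rm →
    inorder (node c l km (plug rm qs)) ⊆ inorder (node c l k (plug (node cm nil km rm) qs))
  replace-by-min-⊆ {qs} spine c l k cm km rm = begin
    L ++ km ∷ Q                                     ∼⟨ ++⁺ ⊆-refl (k ∷ʳ ⊆-refl) ⟩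
    L ++ k ∷ km ∷ Q                                 ≡⟨ cong (λ zs → L ++ k ∷ zs) min-first ⟨
    L ++ k ∷ inorder (plug (node cm nil km rm) qs)  ∎
    where
    open ⊆-Reasoning
    L = inorder l; Q = inorder (plug rm qs)
    min-first : inorder (plug (node cm nil km rm) qs) ≡ km ∷ Q
    min-first = inorder-plug-leftSpine spine (node cm nil km rm) rm (km ∷ []) refl

  key-⊆-inorder : ∀ c l k r → k ∷ [] ⊆ inorder (node c l k r)
  key-⊆-inorder c l k r = ++⁺ˡ (inorder l) (refl ∷ []⊆-universal (inorder r))

  removeAt-⊆ˡ : ∀ c l k ps → contents (removeAt (node c l k nil) ps) ⊆ inorder (plug l ps)
  removeAt-⊆ˡ red   nil                k ps = ⊆-refl
  removeAt-⊆ˡ black nil                k ps = ⊆-refl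
  removeAt-⊆ˡ red   (node c l k r)     _ ps = plug-⊆ _ _ ps (key-⊆-inorder c l k r)
  removeAt-⊆ˡ black (node c l k r)     _ ps = plug-⊆ _ _ ps (key-⊆-inorder c l k r)

  removeAt-⊆ʳ : ∀ c k r ps → contents (removeAt (node c nil k r) ps) ⊆ inorder (plug r ps)
  removeAt-⊆ʳ red   k nil                ps = ⊆-refl
  removeAt-⊆ʳ black k nil                ps = ⊆-refl
  removeAt-⊆ʳ red   _ (node c l k r)     ps = plug-⊆ _ _ ps (key-⊆-inorder c l k r)
  removeAt-⊆ʳ black _ (node c l k r)     ps = plug-⊆ _ _ ps (key-⊆-inorder c l k r)

  removeAt-noRight-⊆ : ∀ c l k ps →
    contents (removeAt (node c l k nil) ps) ⊆ inorder (plug (node c l k nil) ps)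
  removeAt-noRight-⊆ c l k ps = ⊆-trans (removeAt-⊆ˡ c l k ps) (plug-⊆ _ _ ps (++⁺ʳ _ ⊆-refl))

  removeAt-noLeft-⊆ : ∀ c k r ps →
    contents (removeAt (node c nil k r) ps) ⊆ inorder (plug (node c nil k r) ps)
  removeAt-noLeft-⊆ c k r ps = ⊆-trans (removeAt-⊆ʳ c k r ps) (plug-⊆ _ _ ps (k ∷ʳ ⊆-refl))

  transfer-⊆ : ∀ s z ps → contents (transfer s z ps) ⊆ inorder (plug z ps)
  transfer-⊆ predecessor (node c (node c₁ l₁ k₁ r₁) k r@(node _ _ _ _)) ps
    with goMax-spec c₁ l₁ k₁ r₁ []
  ... | cm , lm , km , qs , goMax≡ , plug≡ , spine rewrite goMax≡ = begin
    contents (removeAt (node cm lm km nil) (qs ++ inL c km r ∷ ps))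
      ∼⟨ removeAt-⊆ˡ cm lm km _ ⟩
    inorder (plug lm (qs ++ inL c km r ∷ ps))
      ≡⟨ cong inorder (plug-++ lm qs _) ⟩
    inorder (plug (node c (plug lm qs) km r) ps)
      ∼⟨ plug-⊆ _ _ ps (replace-by-max-⊆ spine c cm lm km k r) ⟩
    inorder (plug (node c (plug (node cm lm km nil) qs) k r) ps)
      ≡⟨ cong (λ l → inorder (plug (node c l k r) ps)) plug≡ ⟩
    inorder (plug (node c (node c₁ l₁ k₁ r₁) k r) ps)
      ∎
    where open ⊆-Reasoning
  transfer-⊆ successor (node c l@(node _ _ _ _) k (node c₂ l₂ k₂ r₂)) ps
    with goMin-spec c₂ l₂ k₂ r₂ []
  ... | cm , km , rm , qs , goMin≡ , plug≡ , spine rewrite goMin≡ = begin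
    contents (removeAt (node cm nil km rm) (qs ++ inR c l km ∷ ps))
      ∼⟨ removeAt-⊆ʳ cm km rm _ ⟩
    inorder (plug rm (qs ++ inR c l km ∷ ps))
      ≡⟨ cong inorder (plug-++ rm qs _) ⟩
    inorder (plug (node c l km (plug rm qs)) ps)
      ∼⟨ plug-⊆ _ _ ps (replace-by-min-⊆ spine c l k cm km rm) ⟩
    inorder (plug (node c l k (plug (node cm nil km rm) qs)) ps)
      ≡⟨ cong (λ r → inorder (plug (node c l k r) ps)) plug≡ ⟩
    inorder (plug (node c l k (node c₂ l₂ k₂ r₂)) ps)
      ∎
    where open ⊆-Reasoning
  transfer-⊆ predecessor nil                             ps = ⊆-refl
  transfer-⊆ successor   nil                             ps = ⊆-refl
  transfer-⊆ predecessor (node c nil k r)                ps = removeAt-noLeft-⊆ c k r ps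
  transfer-⊆ successor   (node c nil k r)                ps = removeAt-noLeft-⊆ c k r ps
  transfer-⊆ predecessor (node c l@(node _ _ _ _) k nil) ps = removeAt-noRight-⊆ c l k ps
  transfer-⊆ successor   (node c l@(node _ _ _ _) k nil) ps = removeAt-noRight-⊆ c l k ps

  startDelete-⊆ : ∀ s k T → contents (startDelete s k T) ⊆ inorder T
  startDelete-⊆ s k T with find k T [] in eq
  ... | nothing       = ⊆-refl
  ... | just (z , qs) =
    ⊆-trans (transfer-⊆ s z qs) (⊆-reflexive (cong inorder (find-plug k T [] eq)))

  data Valid : Tree → ℕ → Set a where
    nil   : Valid nil zero
    black : ∀ {l k r n} → Valid l n → Valid r n → ¬ (colorOf l ≡ red × colorOf r ≡ red) →
            Valid (node black l k r) (suc n)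
    red   : ∀ {l k r n} → Valid l n → Valid r n → colorOf l ≡ black → colorOf r ≡ black →
            Valid (node red l k r) n

  RB⇒Valid : ∀ {t n} → RedParentBlack t → BlackHeight t n → NoTwoRedChildren t → Valid t n
  RB⇒Valid nil nil nil = nil
  RB⇒Valid (node _ pl pr) (black hl hr) (node nb nl nr) =
    black (RB⇒Valid pl hl nl) (RB⇒Valid pr hr nr) nb
  RB⇒Valid (node childrenBlack pl pr) (red hl hr) (node _ nl nr) =
    let lb , rb = childrenBlack refl in red (RB⇒Valid pl hl nl) (RB⇒Valid pr hr nr) lb rb

  Valid⇒RedParentBlack : ∀ {t n} → Valid t n → RedParentBlack t
  Valid⇒RedParentBlack nil               = nil
  Valid⇒RedParentBlack (black vl vr _)   =
    node (λ ()) (Valid⇒RedParentBlack vl) (Valid⇒RedParentBlack vr)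
  Valid⇒RedParentBlack (red vl vr lb rb) =
    node (λ _ → lb , rb) (Valid⇒RedParentBlack vl) (Valid⇒RedParentBlack vr)

  Valid⇒BlackHeight : ∀ {t n} → Valid t n → BlackHeight t n
  Valid⇒BlackHeight nil             = nil
  Valid⇒BlackHeight (black vl vr _) = black (Valid⇒BlackHeight vl) (Valid⇒BlackHeight vr)
  Valid⇒BlackHeight (red vl vr _ _) = red (Valid⇒BlackHeight vl) (Valid⇒BlackHeight vr)

  notBothRedˡ : ∀ {c c′ : Color} → c ≡ black → ¬ (c ≡ red × c′ ≡ red)
  notBothRedˡ refl (() , _)

  notBothRedʳ : ∀ {c c′ : Color} → c′ ≡ black → ¬ (c ≡ red × c′ ≡ red)
  notBothRedʳ refl (_ , ())

  Valid⇒NoTwoRedChildren : ∀ {t n} → Valid t n → NoTwoRedChildren t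
  Valid⇒NoTwoRedChildren nil              = nil
  Valid⇒NoTwoRedChildren (black vl vr nb) =
    node nb (Valid⇒NoTwoRedChildren vl) (Valid⇒NoTwoRedChildren vr)
  Valid⇒NoTwoRedChildren (red vl vr lb _) =
    node (notBothRedˡ lb) (Valid⇒NoTwoRedChildren vl) (Valid⇒NoTwoRedChildren vr)

  raise : Color → ℕ → ℕ
  raise black n = suc n
  raise red   n = n

  valid-node : ∀ c {l k r n} → Valid l n → Valid r n → colorOf l ≡ black → colorOf r ≡ black →
               Valid (node c l k r) (raise c n)
  valid-node black vl vr lb _  = black vl vr (notBothRedˡ lb)
  valid-node red   vl vr lb rb = red vl vr lb rb

  Balanced : Tree → Set a
  Balanced t = colorOf t ≡ black × ∃ (Valid t)

  -- ValidPath ps n c: plugging into ps a valid subtree of black height n and root colour c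
  -- gives a legitimate tree.
  data ValidPath : Path → ℕ → Color → Set a where
    []     : ∀ {n c} → c ≡ black → ValidPath [] n c
    blackˡ : ∀ {k r ps n c} → ValidPath ps (suc n) black → Valid r n →
             ¬ (c ≡ red × colorOf r ≡ red) → ValidPath (inL black k r ∷ ps) n c
    redˡ   : ∀ {k r ps n c} → ValidPath ps n red → Valid r n →
             c ≡ black → colorOf r ≡ black → ValidPath (inL red k r ∷ ps) n c
    blackʳ : ∀ {l k ps n c} → ValidPath ps (suc n) black → Valid l n →
             ¬ (colorOf l ≡ red × c ≡ red) → ValidPath (inR black l k ∷ ps) n c
    redʳ   : ∀ {l k ps n c} → ValidPath ps n red → Valid l n →
             colorOf l ≡ black → c ≡ black → ValidPath (inR red l k ∷ ps) n c

  ValidPath-fromRed : ∀ {ps n c} → ValidPath ps n red → ValidPath ps n c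
  ValidPath-fromRed ([] ())
  ValidPath-fromRed (blackˡ vp vr nb) = blackˡ vp vr (λ (_ , rRed) → nb (refl , rRed))
  ValidPath-fromRed (redˡ _ _ () _)
  ValidPath-fromRed (blackʳ vp vl nb) = blackʳ vp vl (λ (lRed , _) → nb (lRed , refl))
  ValidPath-fromRed (redʳ _ _ _ ())

  plug-valid : ∀ {t ps n} → ValidPath ps n (colorOf t) → Valid t n → Balanced (plug t ps)
  plug-valid ([] tb)            vt = tb , _ , vt
  plug-valid (blackˡ vp vr nb)  vt = plug-valid vp (black vt vr nb)
  plug-valid (redˡ vp vr tb rb) vt = plug-valid vp (red vt vr tb rb)
  plug-valid (blackʳ vp vl nb)  vt = plug-valid vp (black vl vt nb)
  plug-valid (redʳ vp vl lb tb) vt = plug-valid vp (red vl vt lb tb)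

  split-nodeˡ : ∀ {qs n c l k r} k′ → ValidPath qs n c → Valid (node c l k r) n →
                ∃ λ m → ValidPath (inL c k′ r ∷ qs) m (colorOf l) × Valid l m
  split-nodeˡ _ vp (black vl vr nb)  = _ , blackˡ vp vr nb , vl
  split-nodeˡ _ vp (red vl vr lb rb) = _ , redˡ vp vr lb rb , vl

  split-nodeʳ : ∀ {qs n c l k r} k′ → ValidPath qs n c → Valid (node c l k r) n →
                ∃ λ m → ValidPath (inR c l k′ ∷ qs) m (colorOf r) × Valid r m
  split-nodeʳ _ vp (black vl vr nb)  = _ , blackʳ vp vl nb , vr
  split-nodeʳ _ vp (red vl vr lb rb) = _ , redʳ vp vl lb rb , vr

  split-valid : ∀ ps {t T qs n} → plug t ps ≡ T → ValidPath qs n (colorOf T) → Valid T n →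
                ∃ λ m → ValidPath (ps ++ qs) m (colorOf t) × Valid t m
  split-valid []               refl vp vT = _ , vp , vT
  split-valid (inL c k r ∷ ps) {t} refl vp vT =
    let _ , vp′ , vn = split-valid ps {node c t k r} refl vp vT in split-nodeˡ k vp′ vn
  split-valid (inR c l k ∷ ps) {t} refl vp vT =
    let _ , vp′ , vn = split-valid ps {node c l k t} refl vp vT in split-nodeʳ k vp′ vn

  -- Deficient x m: x has black height m and meets the 2-3 conditions ignoring its own
  -- colour; for a red x this is stated through its blackening, the tree Case I produces.
  data Deficient : Tree → ℕ → Set a where
    black : ∀ {x m} → colorOf x ≡ black → Valid x m → Deficient x m
    red   : ∀ {l k r m} → Valid (node black l k r) (suc m) → Deficient (node red l k r) m

  DeficientAt : Tree → Path → Set a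
  DeficientAt x ps = ∃ λ m → Deficient x m × ValidPath ps (suc m) (colorOf x)

  deficientAt-node : ∀ cp {l k r m ps} → Valid (node black l k r) (suc m) →
                     ValidPath ps (raise cp (suc m)) cp → DeficientAt (node cp l k r) ps
  deficientAt-node black v vp = _ , black refl v , vp
  deficientAt-node red   v vp = _ , red v , vp

  Terminates : Result → Set a
  Terminates R = ∃₂ λ n T → run n R ≡ just T × Balanced T

  terminates-done : ∀ {T} → Balanced T → Terminates (done T)
  terminates-done b = 0 , _ , refl , b

  terminates-step : ∀ {x ps} → Terminates (step x ps) → Terminates (fixup x ps)
  terminates-step (n , rest) = suc n , rest

  terminates-stepBlack : ∀ {x f ps} → colorOf x ≡ black →
                         Terminates (stepBlack x (f ∷ ps)) → Terminates (fixup x (f ∷ ps))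
  terminates-stepBlack {nil}               refl (n , rest) = suc n , rest
  terminates-stepBlack {node black _ _ _} refl (n , rest) = suc n , rest

  blacken-black : ∀ {x} → colorOf x ≡ black → blacken x ≡ x
  blacken-black {nil}               refl = refl
  blacken-black {node black _ _ _} refl = refl

  fixup-root : ∀ {x m} → Deficient x m → Terminates (fixup x [])
  fixup-root (black xb vx) =
    terminates-step (terminates-done (subst Balanced (sym (blacken-black xb)) (xb , _ , vx)))
  fixup-root (red v)       = terminates-step (terminates-done (refl , _ , v))

  FixupTerminates : Color → Path → Set a
  FixupTerminates cp ps =
    ∀ {l k r} → DeficientAt (node cp l k r) ps → Terminates (fixup (node cp l k r) ps)

  fixup-red : ∀ ps → FixupTerminates red ps
  fixup-red []       (_ , d , _)          = fixup-root d
  fixup-red (_ ∷ ps) (_ , red v , vp)     =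
    terminates-step (terminates-done (plug-valid (ValidPath-fromRed vp) v))
  fixup-red (_ ∷ ps) (_ , black () _ , _)

  caseIIcL-terminates : ∀ {m} x cp kp a ky b ps → Valid x m → colorOf x ≡ black →
    Valid a m → Valid b m → colorOf b ≡ black → ValidPath ps (raise cp (suc m)) cp →
    FixupTerminates cp ps → Terminates (caseIIcL x cp kp a ky b ps)
  caseIIcL-terminates x cp kp (node red _ _ _) ky b ps vx xb (red va₁ va₂ _ a₂b) vb _ vp _ =
    terminates-done (plug-valid vp
      (valid-node cp (black vx va₁ (notBothRedˡ xb)) (black va₂ vb (notBothRedˡ a₂b)) refl refl))
  caseIIcL-terminates x cp kp nil ky b ps vx xb va vb bb vp ih =
    ih (deficientAt-node cp (black vx (red va vb refl bb) (notBothRedˡ xb)) vp)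
  caseIIcL-terminates x cp kp (node black _ _ _) ky b ps vx xb va vb bb vp ih =
    ih (deficientAt-node cp (black vx (red va vb refl bb) (notBothRedˡ xb)) vp)

  caseIIL-terminates : ∀ {m} x cp kp a ky b ps → Valid x m → colorOf x ≡ black →
    Valid (node black a ky b) (suc m) → ValidPath ps (raise cp (suc m)) cp →
    FixupTerminates cp ps → Terminates (caseIIL x cp kp a ky b ps)
  caseIIL-terminates x cp kp a ky (node red _ _ _) ps vx xb (black va (red vb₁ vb₂ b₁b _) _) vp _ =
    terminates-done (plug-valid vp
      (valid-node cp (black vx va (notBothRedˡ xb)) (black vb₁ vb₂ (notBothRedˡ b₁b)) refl refl))
  caseIIL-terminates x cp kp a ky nil ps vx xb (black va vb _) vp ih =
    caseIIcL-terminates x cp kp a ky nil ps vx xb va vb refl vp ih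
  caseIIL-terminates x cp kp a ky b@(node black _ _ _) ps vx xb (black va vb _) vp ih =
    caseIIcL-terminates x cp kp a ky b ps vx xb va vb refl vp ih

  stepL-terminates : ∀ {m} x cp kp y ps → Valid x m → colorOf x ≡ black →
    ValidPath (inL cp kp y ∷ ps) (suc m) (colorOf x) → FixupTerminates cp ps →
    Terminates (stepL x cp kp y ps)
  stepL-terminates x black kp (node black a ky b) ps vx xb (blackˡ vp vy _) ih =
    caseIIL-terminates x black kp a ky b ps vx xb vy vp ih
  stepL-terminates x red kp (node black a ky b) ps vx xb (redˡ vp vy _ _) ih =
    caseIIL-terminates x red kp a ky b ps vx xb vy vp ih
  stepL-terminates x black kp (node red a ky b) ps vx xb (blackˡ vp (red va vb ab bb) _) _ =
    -- Case III: the new parent of x is red, so the next step is Case II at a red parent.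
    terminates-stepBlack xb
      (stepL-terminates x red kp a (inL black ky b ∷ ps) vx xb
        (redˡ (blackˡ vp vb (notBothRedʳ bb)) va xb ab) (fixup-red _))

  caseIIcR-terminates : ∀ {m} x cp a ky b kp ps → Valid x m → colorOf x ≡ black →
    Valid a m → Valid b m → colorOf a ≡ black → ValidPath ps (raise cp (suc m)) cp →
    FixupTerminates cp ps → Terminates (caseIIcR x cp a ky b kp ps)
  caseIIcR-terminates x cp a ky (node red _ _ _) kp ps vx xb va (red vb₁ vb₂ b₁b _) _ vp _ =
    terminates-done (plug-valid vp
      (valid-node cp (black va vb₁ (notBothRedʳ b₁b)) (black vb₂ vx (notBothRedʳ xb)) refl refl))
  caseIIcR-terminates x cp a ky nil kp ps vx xb va vb ab vp ih =
    ih (deficientAt-node cp (black (red va vb ab refl) vx (notBothRedʳ xb)) vp)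
  caseIIcR-terminates x cp a ky (node black _ _ _) kp ps vx xb va vb ab vp ih =
    ih (deficientAt-node cp (black (red va vb ab refl) vx (notBothRedʳ xb)) vp)

  caseIIR-terminates : ∀ {m} x cp a ky b kp ps → Valid x m → colorOf x ≡ black →
    Valid (node black a ky b) (suc m) → ValidPath ps (raise cp (suc m)) cp →
    FixupTerminates cp ps → Terminates (caseIIR x cp a ky b kp ps)
  caseIIR-terminates x cp (node red _ _ _) ky b kp ps vx xb (black (red va₁ va₂ _ a₂b) vb _) vp _ =
    terminates-done (plug-valid vp
      (valid-node cp (black va₁ va₂ (notBothRedʳ a₂b)) (black vb vx (notBothRedʳ xb)) refl refl))
  caseIIR-terminates x cp nil ky b kp ps vx xb (black va vb _) vp ih =
    caseIIcR-terminates x cp nil ky b kp ps vx xb va vb refl vp ih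
  caseIIR-terminates x cp a@(node black _ _ _) ky b kp ps vx xb (black va vb _) vp ih =
    caseIIcR-terminates x cp a ky b kp ps vx xb va vb refl vp ih

  stepR-terminates : ∀ {m} x cp y kp ps → Valid x m → colorOf x ≡ black →
    ValidPath (inR cp y kp ∷ ps) (suc m) (colorOf x) → FixupTerminates cp ps →
    Terminates (stepR x cp y kp ps)
  stepR-terminates x black (node black a ky b) kp ps vx xb (blackʳ vp vy _) ih =
    caseIIR-terminates x black a ky b kp ps vx xb vy vp ih
  stepR-terminates x red (node black a ky b) kp ps vx xb (redʳ vp vy _ _) ih =
    caseIIR-terminates x red a ky b kp ps vx xb vy vp ih
  stepR-terminates x black (node red a ky b) kp ps vx xb (blackʳ vp (red va vb ab bb) _) _ =
    terminates-stepBlack xb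
      (stepR-terminates x red b kp (inR black a ky ∷ ps) vx xb
        (redʳ (blackʳ vp va (notBothRedˡ ab)) vb bb xb) (fixup-red _))

  fixup-terminates : ∀ x ps → DeficientAt x ps → Terminates (fixup x ps)
  fixup-terminates x [] (_ , d , _) = fixup-root d
  fixup-terminates _ ps@(_ ∷ _) (_ , red v , vp) = fixup-red ps (_ , red v , vp)
  fixup-terminates x (inL cp kp y ∷ ps) (_ , black xb vx , vp) =
    terminates-stepBlack xb (stepL-terminates x cp kp y ps vx xb vp (fixup-terminates _ ps))
  fixup-terminates x (inR cp y kp ∷ ps) (_ , black xb vx , vp) =
    terminates-stepBlack xb (stepR-terminates x cp y kp ps vx xb vp (fixup-terminates _ ps))

  removeAt-terminates : ∀ z ps {n} → ValidPath ps n (colorOf z) → Valid z n →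
                        Terminates (removeAt z ps)
  removeAt-terminates nil ps vp nil = terminates-done (plug-valid vp nil)
  removeAt-terminates (node red nil _ nil) ps vp (red nil nil _ _) =
    terminates-done (plug-valid (ValidPath-fromRed vp) nil)
  removeAt-terminates (node black nil _ nil) ps vp (black nil nil _) =
    fixup-terminates nil ps (_ , black refl nil , vp)
  removeAt-terminates (node black (node _ _ _ _) _ nil) ps vp (black (red _ _ _ _) nil _) =
    terminates-done (plug-valid vp (black nil nil (notBothRedˡ refl)))
  removeAt-terminates (node black nil _ (node _ _ _ _)) ps vp (black nil (red _ _ _ _) _) =
    terminates-done (plug-valid vp (black nil nil (notBothRedˡ refl)))
  removeAt-terminates (node red (node _ _ _ _) _ nil) ps vp (red (red _ _ _ _) nil () _)
  removeAt-terminates (node red   (node _ _ _ _) _ (node _ _ _ _)) ps vp vz =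
    terminates-done (plug-valid vp vz)
  removeAt-terminates (node black (node _ _ _ _) _ (node _ _ _ _)) ps vp vz =
    terminates-done (plug-valid vp vz)

  transfer-terminates : ∀ s z ps {n} → ValidPath ps n (colorOf z) → Valid z n →
                        Terminates (transfer s z ps)
  transfer-terminates predecessor (node c (node c₁ l₁ k₁ r₁) k r@(node _ _ _ _)) ps vp vz
    with goMax-spec c₁ l₁ k₁ r₁ []
  ... | cm , lm , km , qs , goMax≡ , plug≡ , _ rewrite goMax≡ =
    let _ , vpl , vl = split-nodeˡ km vp vz
        _ , vpm , vm = split-valid qs plug≡ vpl vl
    in removeAt-terminates (node cm lm km nil) _ vpm vm
  transfer-terminates successor (node c l@(node _ _ _ _) k (node c₂ l₂ k₂ r₂)) ps vp vz
    with goMin-spec c₂ l₂ k₂ r₂ []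
  ... | cm , km , rm , qs , goMin≡ , plug≡ , _ rewrite goMin≡ =
    let _ , vpr , vr = split-nodeʳ km vp vz
        _ , vpm , vm = split-valid qs plug≡ vpr vr
    in removeAt-terminates (node cm nil km rm) _ vpm vm
  transfer-terminates predecessor z@nil                            ps = removeAt-terminates z ps
  transfer-terminates successor   z@nil                            ps = removeAt-terminates z ps
  transfer-terminates predecessor z@(node _ nil _ _)               ps = removeAt-terminates z ps
  transfer-terminates successor   z@(node _ nil _ _)               ps = removeAt-terminates z ps
  transfer-terminates predecessor z@(node _ (node _ _ _ _) _ nil) ps = removeAt-terminates z ps
  transfer-terminates successor   z@(node _ (node _ _ _ _) _ nil) ps = removeAt-terminates z ps

  startDelete-terminates : ∀ s k {T n} → colorOf T ≡ black → Valid T n →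
                           Terminates (startDelete s k T)
  startDelete-terminates s k {T} Tb vT with find k T [] in eq
  ... | nothing       = terminates-done (Tb , _ , vT)
  ... | just (z , qs) =
    let m , vp , vz = split-valid qs (find-plug k T [] eq) ([] Tb) vT
        vp′ = subst (λ ps → ValidPath ps m (colorOf z)) (++-identityʳ qs) vp
    in transfer-terminates s z qs vp′ vz

proposition2 : ∀ {a ℓ₁ ℓ₂} (O : StrictTotalOrder a ℓ₁ ℓ₂) →
    let open RB O in
    (T : Tree) (k : Key) (s : Side) → Is23RB T → k ∈T T →
    Σ ℕ λ n → Σ Tree λ T′ → run n (startDelete s k T) ≡ just T′ × Is23RB T′
proposition2 O T k s (ordered , rootBlack , redParentBlack , (_ , blackHeight) , noTwoRed) _ =
  let n , T′ , halts , rootBlack′ , _ , valid′ =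
        startDelete-terminates s k rootBlack (RB⇒Valid redParentBlack blackHeight noTwoRed)
      contents⊆ = ⊆-trans (run-⊆ n (startDelete s k T) halts) (startDelete-⊆ s k T)
  in n , T′ , halts ,
     Sorted⇒Ordered T′ (AllPairs-resp-⊆ contents⊆ (Ordered⇒Sorted ordered)) ,
     rootBlack′ , Valid⇒RedParentBlack valid′ , (_ , Valid⇒BlackHeight valid′) ,
     Valid⇒NoTwoRedChildren valid′
  where
  open RB O
  open Deletion O
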